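{- Let $n\ge1$ and let $\gamma_0$ be a Dyck path of length $2n$. Then $$\sum_{\xi:\ (\gamma_0,\xi)\in DH(n)}\omega(\gamma_0,\xi)=\omega_\lambda(\gamma_0),$$ where $\lambda=(\lambda_h)_{h\ge1}$ is given by $\lambda_{2p-1}=\dfrac{(1-q^{p+1})(1-q^p)}{(1-q^2)(1-q)}$ and $\lambda_{2p}=q\lambda_{2p-1}$ for $p\ge1$.
   Context: A Dyck path of length $2n$ is a sequence $\gamma=(p_0,\dots,p_{2n})$ of points of $\mathbb{N}^2$ with $p_0=(0,0)$, $p_{2n}=(2n,0)$, each step $p_i-p_{i-1}$ being $(1,1)$ (up step) or $(1,-1)$ (down step). For a sequence $\mu=(\mu_h)_{h\ge1}$, $\omega_\mu(\gamma)$ is the product, over all down steps $(p_{i-1},p_i)$ of $\gamma$, of $\mu_h$ where $h$ is the height (second coordinate) of $p_{i-1}$. The down steps are numbered $s^d_1,\dots,s^d_n$ from left to right. A Dellac history of length $2n$ is a pair $(\gamma,\xi)$ with $\gamma=(p_0,\dots,p_{2n})$ a Dyck path of length $2n$ and $\xi=(\xi_1,\dots,\xi_n)$, $\xi_i=(n_1(i),n_2(i))$ pairs of nonnegative integers, such that for each $j\in[n]$, with $2k$ the height of $p_{2j-2}$: (1) if $(p_{2j-2},p_{2j-1})$ is a down step $s^d_i$ and $(p_{2j-1},p_{2j})$ is an up step, then $k\ge n_1(i)>n_2(i)\ge0$ and $\omega_i=q^{2k-n_1(i)-n_2(i)}$; (2) if $(p_{2j-2},p_{2j-1})$ is an up step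 and $(p_{2j-1},p_{2j})$ is a down step $s^d_i$, then $0\le n_1(i)\le n_2(i)\le k$ and $\omega_i=q^{2k-n_1(i)-n_2(i)}$; (3) if $(p_{2j-2},p_{2j-1})=s^d_i$ and $(p_{2j-1},p_{2j})=s^d_{i+1}$ are both down steps, then $k-1\ge n_1(i)\ge n_2(i)\ge0$ with $\omega_i=q^{2k-1-n_1(i)-n_2(i)}$, and $0\le n_1(i+1)\le n_2(i+1)\le k-1$ with $\omega_{i+1}=q^{2k-2-n_1(i+1)-n_2(i+1)}$. The weight is $\omega(\gamma,\xi)=\prod_{i=1}^n\omega_i$; $DH(n)$ is the set of Dellac histories of length $2n$. -}

module Defs where

open import Data.Nat as ℕ using (ℕ; zero; suc; _∸_; _<ᵇ_; _≤ᵇ_; _≡ᵇ_)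
open import Data.Nat.DivMod using (_/_)
open import Data.Bool using (Bool; true; false; _∧_; if_then_else_)
open import Data.Product using (_×_; _,_)
open import Data.List using (List; []; _∷_; map; concatMap; upTo; mapMaybe; length; foldr)
open import Data.Maybe using (Maybe; just; nothing)
import Data.Maybe as Maybe
open import Data.Rational using (ℚ; 0ℚ; 1ℚ; _+_; _*_)
open import Relation.Binary.PropositionalEquality using (_≡_)

-- Steps of a lattice path: U = (1,1) (up step), D = (1,-1) (down step).
data Step : Set where
  U D : Step

-- A path starting at (0,0) is given by the list of its steps.
-- dyckFrom h s : starting at height h, the steps s never go below the
-- x-axis and end at height 0.
dyckFrom : ℕ → List Step → Bool
dyckFrom h       []      = h ≡ᵇ 0
dyckFrom h       (U ∷ s) = dyckFrom (suc h) s
dyckFrom zero    (D ∷ s) = false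
dyckFrom (suc h) (D ∷ s) = dyckFrom h s

IsDyck : ℕ → List Step → Set
IsDyck n γ = (length γ ≡ 2 ℕ.* n) × (dyckFrom 0 γ ≡ true)

infixr 8 _^_
_^_ : ℚ → ℕ → ℚ
q ^ zero  = 1ℚ
q ^ suc e = q * (q ^ e)

-- ω_μ(γ): product over the down steps of μ_h, h = height of the start
-- point of the down step.  Argument h = current height.

omegaFrom : (ℕ → ℚ) → ℕ → List Step → ℚ
omegaFrom μ h       []      = 1ℚ
omegaFrom μ h       (U ∷ s) = omegaFrom μ (suc h) s
omegaFrom μ h       (D ∷ s) = μ h * omegaFrom μ (h ∸ 1) s

omega : (ℕ → ℚ) → List Step → ℚ
omega μ γ = omegaFrom μ 0 γ

-- dh q h s ξ : the path steps s are read two at a time, starting at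
-- height h = 2k (the height of p_{2j-2}); ξ lists the pairs
-- (n₁(i), n₂(i)) attached to the down steps, in left-to-right order.
-- Returns  just ∏ ω_i  if the conditions (1)-(3) of the definition of
-- a Dellac history hold, and  nothing  otherwise (including when ξ does
-- not have exactly one pair per down step).

dh : ℚ → ℕ → List Step → List (ℕ × ℕ) → Maybe ℚ
dh q h [] [] = just 1ℚ
dh q h (U ∷ U ∷ s) ξ = dh q (suc (suc h)) s ξ
dh q h (D ∷ U ∷ s) ((a , b) ∷ ξ) =
  let k = h / 2 in
  if (b <ᵇ a) ∧ (a ≤ᵇ k)
  then Maybe.map (λ w → (q ^ (2 ℕ.* k ∸ a ∸ b)) * w) (dh q h s ξ)
  else nothing
dh q h (U ∷ D ∷ s) ((a , b) ∷ ξ) =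
  let k = h / 2 in
  if (a ≤ᵇ b) ∧ (b ≤ᵇ k)
  then Maybe.map (λ w → (q ^ (2 ℕ.* k ∸ a ∸ b)) * w) (dh q h s ξ)
  else nothing
dh q h (D ∷ D ∷ s) ((a , b) ∷ (c , d) ∷ ξ) =
  let k = h / 2 in
  if (1 ℕ.≤ᵇ k) ∧ (b ≤ᵇ a) ∧ (a ≤ᵇ k ∸ 1) ∧ (c ≤ᵇ d) ∧ (d ≤ᵇ k ∸ 1)
  then Maybe.map
         (λ w → (q ^ (2 ℕ.* k ∸ 1 ∸ a ∸ b)) * ((q ^ (2 ℕ.* k ∸ 2 ∸ c ∸ d)) * w))
         (dh q (h ∸ 2) s ξ)
  else nothing
dh q h _ _ = nothing

-- Since every n₁(i), n₂(i)
-- in a Dellac history of length 2n is ≤ k ≤ n, the sequences ξ with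
-- (γ, ξ) ∈ DH(n) are exactly those among  xiCandidates n n  on which
-- dh succeeds.
pairsUpTo : ℕ → List (ℕ × ℕ)
pairsUpTo m = concatMap (λ a → map (λ b → (a , b)) (upTo (suc m))) (upTo (suc m))

xiCandidates : ℕ → ℕ → List (List (ℕ × ℕ))
xiCandidates zero    m = [] ∷ []
xiCandidates (suc n) m =
  concatMap (λ p → map (p ∷_) (xiCandidates n m)) (pairsUpTo m)

sumℚ : List ℚ → ℚ
sumℚ = foldr _+_ 0ℚ

dhSum : ℚ → ℕ → List Step → ℚ
dhSum q n γ = sumℚ (mapMaybe (dh q 0 γ) (xiCandidates n n))

module Submission where

-- The path is read two steps at a time from an even height 2k.  A block UU
-- carries no pair; each of the blocks UD, DU, DD carries weights depending only
-- on its own pairs (n₁, n₂), so the sum over all sequences ξ factorises into a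
-- product of block sums (sumMap-extend-product).  Every block sum is, up to a
-- factor q and the symmetry (a, b) ↦ (b, a), the triangular sum
--   T(k) = Σ_{0 ≤ a ≤ b ≤ k} q^{2k-a-b}:
--   UD at height 2k gives T(k) = λ_{2k+1},   DU at height 2k+2 gives q·T(k) = λ_{2k+2},
--   DD at height 2k+2 gives q·T(k)·T(k) = λ_{2k+2}·λ_{2k+1},
-- exactly the factors of ω_λ for these two steps.  T(k) is the Gaussian
-- binomial [k+2 choose 2]_q: peeling off the row a = 0 leaves a geometric sum,
-- whence T(k)(1-q²)(1-q) = (1-q^{k+2})(1-q^{k+1}), and cancelling
-- (1-q²)(1-q) ≠ 0 identifies T(k) with λ_{2k+1}.

open import Defs
open import Data.Nat using (ℕ; suc; _≥_)
open import Data.List using (List)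
open import Data.Rational using (ℚ; 1ℚ; _-_; _*_; -_)
open import Relation.Binary.PropositionalEquality using (_≡_; _≢_)

open import Data.Nat as ℕ using (zero; _∸_; _≤_; _<_; _≤ᵇ_; _<ᵇ_; z≤n; s≤s)
import Data.Nat.Properties as ℕₚ
open import Data.Nat.DivMod using (_/_; m*n/n≡m)
open import Data.Bool using (Bool; true; false; _∧_; if_then_else_; T)
import Data.Bool.Properties as Boolₚ
open import Data.List using ([]; _∷_; _++_; map; concatMap; mapMaybe; applyUpTo; upTo; length)
import Data.List.Properties as Listₚ
open import Data.Maybe using (Maybe; just; nothing)
import Data.Maybe as Maybe
open import Data.Product using (_×_; _,_; uncurry)
open import Data.Rational using (0ℚ; _+_; 1/_; NonZero; ≢-nonZero)
import Data.Rational.Properties as ℚₚ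
open import Data.Rational.Solver using (module +-*-Solver)
open +-*-Solver using (solve; _:=_; _:+_; _:*_; _:-_; con)
open import Data.Empty using (⊥-elim)
open import Function using (_∘_; Equivalence)
open import Relation.Binary.PropositionalEquality
  using (refl; sym; trans; cong; cong₂; module ≡-Reasoning)

sumTo : ℕ → (ℕ → ℚ) → ℚ
sumTo zero    g = 0ℚ
sumTo (suc N) g = g 0 + sumTo N (g ∘ suc)

sumTo-cong : ∀ N {g g′ : ℕ → ℚ} → (∀ i → g i ≡ g′ i) → sumTo N g ≡ sumTo N g′
sumTo-cong zero    e = refl
sumTo-cong (suc N) e = cong₂ _+_ (e 0) (sumTo-cong N (e ∘ suc))

sumTo-zero : ∀ N {g : ℕ → ℚ} → (∀ i → g i ≡ 0ℚ) → sumTo N g ≡ 0ℚ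
sumTo-zero zero    e = refl
sumTo-zero (suc N) e = cong₂ _+_ (e 0) (sumTo-zero N (e ∘ suc))

sumTo-+ : ∀ N (g h : ℕ → ℚ) → sumTo N (λ i → g i + h i) ≡ sumTo N g + sumTo N h
sumTo-+ zero    g h = refl
sumTo-+ (suc N) g h =
  trans (cong ((g 0 + h 0) +_) (sumTo-+ N (g ∘ suc) (h ∘ suc)))
        (interchange (g 0) (h 0) (sumTo N (g ∘ suc)) (sumTo N (h ∘ suc)))
  where
  interchange : ∀ a b c d → (a + b) + (c + d) ≡ (a + c) + (b + d)
  interchange = solve 4 (λ a b c d → (a :+ b) :+ (c :+ d) := (a :+ c) :+ (b :+ d)) refl

sumTo-*ˡ : ∀ N c (g : ℕ → ℚ) → sumTo N (λ i → c * g i) ≡ c * sumTo N g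
sumTo-*ˡ zero    c g = sym (ℚₚ.*-zeroʳ c)
sumTo-*ˡ (suc N) c g =
  trans (cong (c * g 0 +_) (sumTo-*ˡ N c (g ∘ suc))) (sym (ℚₚ.*-distribˡ-+ c _ _))

sumTo² : ℕ → ℕ → (ℕ → ℕ → ℚ) → ℚ
sumTo² N₁ N₂ g = sumTo N₁ (λ a → sumTo N₂ (g a))

sumTo²-transpose : ∀ N₁ N₂ g → sumTo² N₁ N₂ g ≡ sumTo² N₂ N₁ (λ b a → g a b)
sumTo²-transpose zero     N₂ g = sym (sumTo-zero N₂ (λ _ → refl))
sumTo²-transpose (suc N₁) N₂ g = begin
  sumTo N₂ (g 0) + sumTo² N₁ N₂ (g ∘ suc)
    ≡⟨ cong (sumTo N₂ (g 0) +_) (sumTo²-transpose N₁ N₂ (g ∘ suc)) ⟩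
  sumTo N₂ (g 0) + sumTo² N₂ N₁ (λ b a → g (suc a) b)
    ≡⟨ sym (sumTo-+ N₂ (g 0) _) ⟩
  sumTo² N₂ (suc N₁) (λ b a → g a b) ∎
  where open ≡-Reasoning

sumTo²-peel : ∀ N₁ N₂ g → sumTo² (suc N₁) (suc N₂) g
  ≡ (g 0 0 + sumTo N₂ (g 0 ∘ suc))
    + (sumTo N₁ (λ a → g (suc a) 0) + sumTo² N₁ N₂ (λ a b → g (suc a) (suc b)))
sumTo²-peel N₁ N₂ g =
  cong ((g 0 0 + sumTo N₂ (g 0 ∘ suc)) +_)
       (sumTo-+ N₁ (λ a → g (suc a) 0) (λ a → sumTo N₂ (λ b → g (suc a) (suc b))))

private variable A B : Set

sumMap : (A → ℚ) → List A → ℚ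
sumMap f xs = sumℚ (map f xs)

sumMap-cong : {f g : A → ℚ} → (∀ x → f x ≡ g x) → ∀ xs → sumMap f xs ≡ sumMap g xs
sumMap-cong e xs = cong sumℚ (Listₚ.map-cong e xs)

sumMap-++ : (f : A → ℚ) → ∀ xs ys → sumMap f (xs ++ ys) ≡ sumMap f xs + sumMap f ys
sumMap-++ f []       ys = sym (ℚₚ.+-identityˡ _)
sumMap-++ f (x ∷ xs) ys = trans (cong (f x +_) (sumMap-++ f xs ys)) (sym (ℚₚ.+-assoc (f x) _ _))

sumMap-*ˡ : ∀ c (f : A → ℚ) xs → sumMap (λ x → c * f x) xs ≡ c * sumMap f xs
sumMap-*ˡ c f []       = sym (ℚₚ.*-zeroʳ c)
sumMap-*ˡ c f (x ∷ xs) = trans (cong (c * f x +_) (sumMap-*ˡ c f xs)) (sym (ℚₚ.*-distribˡ-+ c (f x) (sumMap f xs)))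

sumMap-*ʳ : ∀ c (f : A → ℚ) xs → sumMap (λ x → f x * c) xs ≡ sumMap f xs * c
sumMap-*ʳ c f []       = sym (ℚₚ.*-zeroˡ c)
sumMap-*ʳ c f (x ∷ xs) = trans (cong (f x * c +_) (sumMap-*ʳ c f xs)) (sym (ℚₚ.*-distribʳ-+ c (f x) (sumMap f xs)))

sumMap-map : (f : B → ℚ) (g : A → B) → ∀ xs → sumMap f (map g xs) ≡ sumMap (f ∘ g) xs
sumMap-map f g xs = cong sumℚ (sym (Listₚ.map-∘ xs))

sumMap-concatMap : (f : B → ℚ) (g : A → List B) → ∀ xs →
                   sumMap f (concatMap g xs) ≡ sumMap (λ x → sumMap f (g x)) xs
sumMap-concatMap f g []       = refl
sumMap-concatMap f g (x ∷ xs) =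
  trans (sumMap-++ f (g x) (concatMap g xs)) (cong (sumMap f (g x) +_) (sumMap-concatMap f g xs))

sumMap-applyUpTo : (f : A → ℚ) (g : ℕ → A) → ∀ N → sumMap f (applyUpTo g N) ≡ sumTo N (f ∘ g)
sumMap-applyUpTo f g zero    = refl
sumMap-applyUpTo f g (suc N) = cong (f (g 0) +_) (sumMap-applyUpTo f (g ∘ suc) N)

sumMap-pairsUpTo : ∀ (w : ℕ × ℕ → ℚ) m →
                   sumMap w (pairsUpTo m) ≡ sumTo² (suc m) (suc m) (λ a b → w (a , b))
sumMap-pairsUpTo w m =
  trans (sumMap-concatMap w row (upTo (suc m)))
    (trans (sumMap-applyUpTo (λ a → sumMap w (row a)) (λ a → a) (suc m))
      (sumTo-cong (suc m) λ a →
        trans (sumMap-map w (a ,_) (upTo (suc m))) (sumMap-applyUpTo (w ∘ (a ,_)) (λ b → b) (suc m))))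
  where
  row : ℕ → List (ℕ × ℕ)
  row a = map (a ,_) (upTo (suc m))

-- all sequences of C, each prefixed by each element of P in turn;
-- xiCandidates (suc j) m is  extend (pairsUpTo m) (xiCandidates j m)
extend : List A → List (List A) → List (List A)
extend P C = concatMap (λ p → map (p ∷_) C) P

sumMap-extend : (F : List A → ℚ) → ∀ P C →
                sumMap F (extend P C) ≡ sumMap (λ p → sumMap (λ ξ → F (p ∷ ξ)) C) P
sumMap-extend F P C =
  trans (sumMap-concatMap F (λ p → map (p ∷_) C) P) (sumMap-cong (λ p → sumMap-map F (p ∷_) C) P)

sumMap-extend-product : (F : List A → ℚ) (f : A → ℚ) (g : List A → ℚ) →
  (∀ p ξ → F (p ∷ ξ) ≡ f p * g ξ) → ∀ P C → sumMap F (extend P C) ≡ sumMap f P * sumMap g C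
sumMap-extend-product F f g split P C =
  trans (sumMap-extend F P C)
    (trans (sumMap-cong (λ p → trans (sumMap-cong (split p) C) (sumMap-*ˡ (f p) g C)) P)
           (sumMap-*ʳ (sumMap g C) f P))

value : Maybe ℚ → ℚ
value nothing  = 0ℚ
value (just w) = w

sumℚ-mapMaybe : (F : A → Maybe ℚ) → ∀ xs → sumℚ (mapMaybe F xs) ≡ sumMap (value ∘ F) xs
sumℚ-mapMaybe F []       = refl
sumℚ-mapMaybe F (x ∷ xs) with F x
... | just w  = cong (w +_) (sumℚ-mapMaybe F xs)
... | nothing = trans (sumℚ-mapMaybe F xs) (sym (ℚₚ.+-identityˡ _))

value-guard : ∀ c {x} {φ : ℚ → ℚ} → (∀ w → φ w ≡ x * w) →
              ∀ m → value (if c then Maybe.map φ m else nothing) ≡ (if c then x else 0ℚ) * value m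
value-guard false     φ≡ m        = sym (ℚₚ.*-zeroˡ (value m))
value-guard true {x}  φ≡ nothing  = sym (ℚₚ.*-zeroʳ x)
value-guard true      φ≡ (just w) = φ≡ w

guard-cong : ∀ {c c′ : Bool} {x x′ : ℚ} → c ≡ c′ → (T c′ → x ≡ x′) →
             (if c then x else 0ℚ) ≡ (if c′ then x′ else 0ℚ)
guard-cong {c′ = true}  refl x≡ = x≡ _
guard-cong {c′ = false} refl x≡ = refl

guard-*ˡ : ∀ c x y → (if c then x * y else 0ℚ) ≡ x * (if c then y else 0ℚ)
guard-*ˡ true  x y = refl
guard-*ˡ false x y = sym (ℚₚ.*-zeroʳ x)

guard-∧ : ∀ c c′ x y → (if c ∧ c′ then x * y else 0ℚ) ≡ (if c then x else 0ℚ) * (if c′ then y else 0ℚ)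
guard-∧ true  c′ x y = guard-*ˡ c′ x y
guard-∧ false c′ x y = sym (ℚₚ.*-zeroˡ (if c′ then y else 0ℚ))

<ᵇ-suc : ∀ a b → (a <ᵇ suc b) ≡ (a ≤ᵇ b)
<ᵇ-suc zero    b = refl
<ᵇ-suc (suc a) b = refl

≤ᵇ-chain : ∀ a b c → T ((a ≤ᵇ b) ∧ (b ≤ᵇ c)) → a ≤ b × b ≤ c
≤ᵇ-chain a b c t with Equivalence.to Boolₚ.T-∧ t
... | ta , tb = ℕₚ.≤ᵇ⇒≤ a b ta , ℕₚ.≤ᵇ⇒≤ b c tb

two-suc : ∀ k → 2 ℕ.* suc k ≡ suc (suc (2 ℕ.* k))
two-suc k = ℕₚ.*-suc 2 k

halve : ∀ k {h} → h ≡ 2 ℕ.* k → h / 2 ≡ k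
halve k refl = trans (cong (_/ 2) (ℕₚ.*-comm 2 k)) (m*n/n≡m k 2)

half-bound : ∀ k {h m} → h ≡ 2 ℕ.* k → h ≤ m → k ≤ m
half-bound k refl h≤m = ℕₚ.≤-trans (ℕₚ.m≤m+n k _) h≤m

-- 1 is odd: the parity obstruction for a lone down step
odd≢even : ∀ k → 1 ≢ 2 ℕ.* k
odd≢even zero    ()
odd≢even (suc k) e with ℕₚ.suc-injective (trans e (two-suc k))
... | ()

shift-exponent : ∀ k a b → a ≤ k → 2 ℕ.* suc k ∸ suc a ∸ suc b ≡ 2 ℕ.* k ∸ a ∸ b
shift-exponent k a b a≤k =
  trans (cong (λ e → e ∸ a ∸ suc b) (ℕₚ.+-suc k (k ℕ.+ 0)))
        (cong (_∸ suc b) (ℕₚ.+-∸-assoc 1 (ℕₚ.≤-trans a≤k (ℕₚ.m≤m+n k _))))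

odd-exponent : ∀ k a b → b ≤ a → a ≤ k → 2 ℕ.* suc k ∸ 1 ∸ a ∸ b ≡ suc (2 ℕ.* k ∸ b ∸ a)
odd-exponent k a b b≤a a≤k = begin
  (k ℕ.+ suc (k ℕ.+ 0)) ∸ a ∸ b   ≡⟨ cong (λ e → e ∸ a ∸ b) (ℕₚ.+-suc k (k ℕ.+ 0)) ⟩
  suc (2 ℕ.* k) ∸ a ∸ b           ≡⟨ ℕₚ.∸-+-assoc (suc (2 ℕ.* k)) a b ⟩
  suc (2 ℕ.* k) ∸ (a ℕ.+ b)       ≡⟨ ℕₚ.+-∸-assoc 1 a+b≤2k ⟩
  suc (2 ℕ.* k ∸ (a ℕ.+ b))       ≡⟨ cong (λ e → suc (2 ℕ.* k ∸ e)) (ℕₚ.+-comm a b) ⟩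
  suc (2 ℕ.* k ∸ (b ℕ.+ a))       ≡⟨ cong suc (sym (ℕₚ.∸-+-assoc (2 ℕ.* k) b a)) ⟩
  suc (2 ℕ.* k ∸ b ∸ a)           ∎
  where
  open ≡-Reasoning
  a+b≤2k : a ℕ.+ b ≤ 2 ℕ.* k
  a+b≤2k = ℕₚ.+-mono-≤ a≤k (ℕₚ.≤-trans (ℕₚ.≤-trans b≤a a≤k) (ℕₚ.m≤m+n k 0))

even-exponent : ∀ k c d → 2 ℕ.* suc k ∸ 2 ∸ c ∸ d ≡ 2 ℕ.* k ∸ c ∸ d
even-exponent k c d = cong (λ e → e ∸ 1 ∸ c ∸ d) (ℕₚ.+-suc k (k ℕ.+ 0))

-- number of down steps; a Dellac history attaches one pair to each of them
downSteps : List Step → ℕ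
downSteps []      = 0
downSteps (U ∷ s) = downSteps s
downSteps (D ∷ s) = suc (downSteps s)

descent : ∀ h s → dyckFrom h s ≡ true → h ≤ downSteps s
descent zero    []      _ = z≤n
descent (suc h) []      ()
descent h       (U ∷ s) d = ℕₚ.≤-trans (ℕₚ.n≤1+n h) (descent (suc h) s d)
descent zero    (D ∷ s) _ = z≤n
descent (suc h) (D ∷ s) d = s≤s (descent h s d)

length-downSteps : ∀ h s → dyckFrom h s ≡ true → h ℕ.+ length s ≡ 2 ℕ.* downSteps s
length-downSteps zero    []      _  = refl
length-downSteps (suc h) []      ()
length-downSteps h       (U ∷ s) d  = trans (ℕₚ.+-suc h (length s)) (length-downSteps (suc h) s d)
length-downSteps zero    (D ∷ s) ()
length-downSteps (suc h) (D ∷ s) d  =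
  trans (cong suc (ℕₚ.+-suc h (length s)))
        (trans (cong (suc ∘ suc) (length-downSteps h s d)) (sym (two-suc (downSteps s))))

*-cancelʳ : ∀ {x y c : ℚ} → c ≢ 0ℚ → x * c ≡ y * c → x ≡ y
*-cancelʳ {x} {y} {c} c≢0 e = begin
  x                ≡⟨ sym (ℚₚ.*-identityʳ x) ⟩
  x * 1ℚ           ≡⟨ cong (x *_) (sym (ℚₚ.*-inverseʳ c)) ⟩
  x * (c * 1/ c)   ≡⟨ sym (ℚₚ.*-assoc x c _) ⟩
  (x * c) * 1/ c   ≡⟨ cong (_* 1/ c) e ⟩
  (y * c) * 1/ c   ≡⟨ ℚₚ.*-assoc y c _ ⟩
  y * (c * 1/ c)   ≡⟨ cong (y *_) (ℚₚ.*-inverseʳ c) ⟩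
  y * 1ℚ           ≡⟨ ℚₚ.*-identityʳ y ⟩
  y                ∎
  where
  open ≡-Reasoning
  instance
    c-nonZero : NonZero c
    c-nonZero = ≢-nonZero c≢0

*-≢0 : ∀ {x y : ℚ} → x ≢ 0ℚ → y ≢ 0ℚ → x * y ≢ 0ℚ
*-≢0 {x} {y} x≢0 y≢0 xy≡0 = x≢0 (*-cancelʳ y≢0 (trans xy≡0 (sym (ℚₚ.*-zeroˡ y))))

denominator≢0 : ∀ q → q ≢ 1ℚ → q ≢ - 1ℚ → (1ℚ - q ^ 2) * (1ℚ - q) ≢ 0ℚ
denominator≢0 q q≢1 q≢-1 =
  *-≢0 (λ e → *-≢0 1-q≢0 1+q≢0 (trans (difference-of-squares q) e)) 1-q≢0
  where
  1-q≢0 : 1ℚ - q ≢ 0ℚ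
  1-q≢0 e = q≢1 (trans (solve 1 (λ q → q := con 1ℚ :- (con 1ℚ :- q)) refl q) (cong (λ z → 1ℚ - z) e))
  1+q≢0 : 1ℚ + q ≢ 0ℚ
  1+q≢0 e = q≢-1 (trans (solve 1 (λ q → q := (con 1ℚ :+ q) :- con 1ℚ) refl q) (cong (_- 1ℚ) e))
  difference-of-squares : ∀ q → (1ℚ - q) * (1ℚ + q) ≡ 1ℚ - q ^ 2
  difference-of-squares = solve 1 (λ q → (con 1ℚ :- q) :* (con 1ℚ :+ q) := con 1ℚ :- q :* (q :* con 1ℚ)) refl

-- The triangular sum  T(k) = Σ_{0 ≤ a ≤ b ≤ k} q^{2k-a-b}

module Triangle (q : ℚ) where

  pow-+ : ∀ m n → q ^ (m ℕ.+ n) ≡ q ^ m * q ^ n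
  pow-+ zero    n = sym (ℚₚ.*-identityˡ _)
  pow-+ (suc m) n = trans (cong (q *_) (pow-+ m n)) (sym (ℚₚ.*-assoc q _ _))

  pow-+ʳ : ∀ k r → q ^ (k ℕ.+ r) ≡ q ^ (r ℕ.+ k)
  pow-+ʳ k r = cong (q ^_) (ℕₚ.+-comm k r)

  -- the summand of T(k); it is also the weight of a UD block at height 2k
  triangle : ℕ → ℕ → ℕ → ℚ
  triangle k a b = if (a ≤ᵇ b) ∧ (b ≤ᵇ k) then q ^ (2 ℕ.* k ∸ a ∸ b) else 0ℚ

  -- the transposed summand, which arises from conditions (1) and (3)
  triangleᵀ : ℕ → ℕ → ℕ → ℚ
  triangleᵀ k a b = triangle k b a

  triangle-shift : ∀ k a b → triangle (suc k) (suc a) (suc b) ≡ triangle k a b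
  triangle-shift k a b = guard-cong (cong₂ _∧_ (<ᵇ-suc a b) (<ᵇ-suc b k)) λ t →
    let (a≤b , b≤k) = ≤ᵇ-chain a b k t in cong (q ^_) (shift-exponent k a b (ℕₚ.≤-trans a≤b b≤k))

  geometric : ℕ → ℕ → ℕ → ℚ
  geometric N e k = sumTo N (λ b → if b ≤ᵇ k then q ^ (e ∸ b) else 0ℚ)

  geometric-sum : ∀ k r N → k < N → geometric N (k ℕ.+ r) k * (1ℚ - q) ≡ q ^ r - q ^ suc (k ℕ.+ r)
  geometric-sum zero    r (suc N) _ = begin
    (q ^ r + sumTo N (λ _ → 0ℚ)) * (1ℚ - q)
      ≡⟨ cong (λ z → (q ^ r + z) * (1ℚ - q)) (sumTo-zero N (λ _ → refl)) ⟩
    (q ^ r + 0ℚ) * (1ℚ - q)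
      ≡⟨ solve 2 (λ q y → (y :+ con 0ℚ) :* (con 1ℚ :- q) := y :- q :* y) refl q (q ^ r) ⟩
    q ^ r - q * q ^ r                         ∎
    where open ≡-Reasoning
  geometric-sum (suc k) r (suc N) (s≤s k<N) = begin
    (X + sumTo N (λ b → if b <ᵇ suc k then q ^ (k ℕ.+ r ∸ b) else 0ℚ)) * (1ℚ - q)
      ≡⟨ cong (λ z → (X + z) * (1ℚ - q)) (sumTo-cong N (λ b → guard-cong (<ᵇ-suc b k) (λ _ → refl))) ⟩
    (X + geometric N (k ℕ.+ r) k) * (1ℚ - q)
      ≡⟨ ℚₚ.*-distribʳ-+ (1ℚ - q) X _ ⟩
    X * (1ℚ - q) + geometric N (k ℕ.+ r) k * (1ℚ - q)
      ≡⟨ cong (X * (1ℚ - q) +_) (geometric-sum k r N k<N) ⟩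
    X * (1ℚ - q) + (q ^ r - X)
      ≡⟨ solve 3 (λ q x y → x :* (con 1ℚ :- q) :+ (y :- x) := y :- q :* x) refl q X (q ^ r) ⟩
    q ^ r - q * X ∎
    where
    open ≡-Reasoning
    X = q ^ suc (k ℕ.+ r)

  triangle-zero : ∀ N₁ N₂ → sumTo² (suc N₁) (suc N₂) (triangle 0) ≡ 1ℚ
  triangle-zero N₁ N₂ = trans (sumTo²-peel N₁ N₂ (triangle 0))
    (cong₂ (λ u v → (1ℚ + u) + v) (sumTo-zero N₂ (λ _ → refl))
      (cong₂ _+_ (sumTo-zero N₁ (λ _ → refl))
                 (sumTo-zero N₁ λ a → sumTo-zero N₂ λ b →
                   cong (λ c → if c then _ else 0ℚ) (Boolₚ.∧-zeroʳ (a <ᵇ suc b)))))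

  triangle-peel : ∀ k N₁ N₂ → sumTo² (suc N₁) (suc N₂) (triangle (suc k))
    ≡ (q ^ (2 ℕ.* suc k) + geometric N₂ (2 ℕ.* suc k ∸ 1) k) + sumTo² N₁ N₂ (triangle k)
  triangle-peel k N₁ N₂ = trans (sumTo²-peel N₁ N₂ (triangle (suc k)))
    (cong₂ (λ u v → (q ^ (2 ℕ.* suc k) + u) + v)
      (sumTo-cong N₂ (λ b → guard-cong (<ᵇ-suc b k) (λ _ → refl)))
      (trans (cong₂ _+_ (sumTo-zero N₁ (λ _ → refl))
                        (sumTo-cong N₁ λ a → sumTo-cong N₂ (triangle-shift k a)))
             (ℚₚ.+-identityˡ _)))

  denominator : ℚ
  denominator = (1ℚ - q ^ 2) * (1ℚ - q)

  -- the induction step of the q-binomial identity, with x standing for q^k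
  triangle-step : ∀ x P G T → P ≡ (q * x) * (q * x) → G * (1ℚ - q) ≡ q * x - P →
    T * denominator ≡ (1ℚ - q * (q * x)) * (1ℚ - q * x) →
    ((P + G) + T) * denominator ≡ (1ℚ - q * (q * (q * x))) * (1ℚ - q * (q * x))
  triangle-step x _ G T refl G-eq T-eq = begin
    ((P + G) + T) * denominator
      ≡⟨ solve 5 (λ q x P G T → ((P :+ G) :+ T) :* ((con 1ℚ :- q :* (q :* con 1ℚ)) :* (con 1ℚ :- q))
                   := P :* ((con 1ℚ :- q :* (q :* con 1ℚ)) :* (con 1ℚ :- q))
                      :+ (G :* (con 1ℚ :- q)) :* (con 1ℚ :- q :* (q :* con 1ℚ))
                      :+ T :* ((con 1ℚ :- q :* (q :* con 1ℚ)) :* (con 1ℚ :- q))) refl q x P G T ⟩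
    P * denominator + (G * (1ℚ - q)) * (1ℚ - q ^ 2) + T * denominator
      ≡⟨ cong₂ (λ u v → P * denominator + u * (1ℚ - q ^ 2) + v) G-eq T-eq ⟩
    P * denominator + (q * x - P) * (1ℚ - q ^ 2) + (1ℚ - q * (q * x)) * (1ℚ - q * x)
      ≡⟨ solve 2 (λ q x → (q :* x :* (q :* x)) :* ((con 1ℚ :- q :* (q :* con 1ℚ)) :* (con 1ℚ :- q))
                   :+ (q :* x :- q :* x :* (q :* x)) :* (con 1ℚ :- q :* (q :* con 1ℚ))
                   :+ (con 1ℚ :- q :* (q :* x)) :* (con 1ℚ :- q :* x)
                   := (con 1ℚ :- q :* (q :* (q :* x))) :* (con 1ℚ :- q :* (q :* x))) refl q x ⟩
    (1ℚ - q * (q * (q * x))) * (1ℚ - q * (q * x)) ∎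
    where
    open ≡-Reasoning
    P = (q * x) * (q * x)

  numerator-form : ∀ k → (1ℚ - q ^ (k ℕ.+ 2)) * (1ℚ - q ^ (k ℕ.+ 1))
                         ≡ (1ℚ - q * (q * q ^ k)) * (1ℚ - q * q ^ k)
  numerator-form k = cong₂ (λ u v → (1ℚ - u) * (1ℚ - v)) (pow-+ʳ k 2) (pow-+ʳ k 1)

  triangle-sum : ∀ k N₁ N₂ → k < N₁ → k < N₂ →
    sumTo² N₁ N₂ (triangle k) * denominator ≡ (1ℚ - q ^ (k ℕ.+ 2)) * (1ℚ - q ^ (k ℕ.+ 1))
  triangle-sum zero (suc N₁) (suc N₂) _ _ =
    trans (cong (_* denominator) (triangle-zero N₁ N₂))
      (solve 1 (λ q → con 1ℚ :* ((con 1ℚ :- q :* (q :* con 1ℚ)) :* (con 1ℚ :- q))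
                    := (con 1ℚ :- q :* (q :* con 1ℚ)) :* (con 1ℚ :- q :* con 1ℚ)) refl q)
  triangle-sum (suc k) (suc N₁) (suc N₂) (s≤s k<N₁) (s≤s k<N₂) =
    trans (cong (_* denominator) (triangle-peel k N₁ N₂))
      (trans (triangle-step (q ^ k) _ _ _ corner
                (trans (geometric-sum k (suc (k ℕ.+ 0)) N₂ k<N₂)
                       (cong (λ e → q * q ^ e - q ^ (2 ℕ.* suc k)) (ℕₚ.+-identityʳ k)))
                (trans (triangle-sum k N₁ N₂ k<N₁ k<N₂) (numerator-form k)))
             (sym (numerator-form (suc k))))
    where
    corner : q ^ (2 ℕ.* suc k) ≡ (q * q ^ k) * (q * q ^ k)
    corner = trans (pow-+ (suc k) (suc k ℕ.+ 0)) (cong (λ e → q * q ^ k * q ^ e) (ℕₚ.+-identityʳ (suc k)))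

-- The blocks of a Dellac history

module Blocks (q : ℚ) where
  open Triangle q

  historyTotal : ℕ → List Step → List (List (ℕ × ℕ)) → ℚ
  historyTotal h s C = sumMap (value ∘ dh q h s) C

  weightDU : ℕ → ℕ × ℕ → ℚ
  weightDU K (a , b) = if (b <ᵇ a) ∧ (a ≤ᵇ K) then q ^ (2 ℕ.* K ∸ a ∸ b) else 0ℚ

  weightDD : ℕ → ℕ × ℕ → ℕ × ℕ → ℚ
  weightDD K (a , b) (c , d) =
    if (1 ℕ.≤ᵇ K) ∧ (b ≤ᵇ a) ∧ (a ≤ᵇ K ∸ 1) ∧ (c ≤ᵇ d) ∧ (d ≤ᵇ K ∸ 1)
    then q ^ (2 ℕ.* K ∸ 1 ∸ a ∸ b) * q ^ (2 ℕ.* K ∸ 2 ∸ c ∸ d) else 0ℚ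

  factor-UD : ∀ h s p ξ →
              value (dh q h (U ∷ D ∷ s) (p ∷ ξ)) ≡ uncurry (triangle (h / 2)) p * value (dh q h s ξ)
  factor-UD h s (a , b) ξ = value-guard ((a ≤ᵇ b) ∧ (b ≤ᵇ h / 2)) (λ _ → refl) (dh q h s ξ)

  factor-DU : ∀ h s p ξ → value (dh q h (D ∷ U ∷ s) (p ∷ ξ)) ≡ weightDU (h / 2) p * value (dh q h s ξ)
  factor-DU h s (a , b) ξ = value-guard ((b <ᵇ a) ∧ (a ≤ᵇ h / 2)) (λ _ → refl) (dh q h s ξ)

  factor-DD : ∀ h s p₁ p₂ ξ →
    value (dh q h (D ∷ D ∷ s) (p₁ ∷ p₂ ∷ ξ)) ≡ weightDD (h / 2) p₁ p₂ * value (dh q (h ∸ 2) s ξ)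
  factor-DD h s (a , b) (c , d) ξ =
    value-guard ((1 ℕ.≤ᵇ K) ∧ (b ≤ᵇ a) ∧ (a ≤ᵇ K ∸ 1) ∧ (c ≤ᵇ d) ∧ (d ≤ᵇ K ∸ 1))
                (λ w → sym (ℚₚ.*-assoc (q ^ (2 ℕ.* K ∸ 1 ∸ a ∸ b)) (q ^ (2 ℕ.* K ∸ 2 ∸ c ∸ d)) w))
                (dh q (h ∸ 2) s ξ)
    where K = h / 2

  weightDU-shift : ∀ k a b → weightDU (suc k) (suc a , b) ≡ q * triangleᵀ k a b
  weightDU-shift k a b =
    trans (guard-cong (cong₂ _∧_ (<ᵇ-suc b a) (<ᵇ-suc a k)) λ t →
             let (b≤a , a≤k) = ≤ᵇ-chain b a k t in cong (q ^_) (odd-exponent k a b b≤a a≤k))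
          (guard-*ˡ ((b ≤ᵇ a) ∧ (a ≤ᵇ k)) q _)

  weightDD-split : ∀ k a b c d → weightDD (suc k) (a , b) (c , d) ≡ (q * triangleᵀ k a b) * triangle k c d
  weightDD-split k a b c d = begin
    weightDD (suc k) (a , b) (c , d)
      ≡⟨ guard-cong (sym (Boolₚ.∧-assoc (b ≤ᵇ a) (a ≤ᵇ k) _)) (λ _ → refl) ⟩
    (if ((b ≤ᵇ a) ∧ (a ≤ᵇ k)) ∧ ((c ≤ᵇ d) ∧ (d ≤ᵇ k)) then X * Y else 0ℚ)
      ≡⟨ guard-∧ ((b ≤ᵇ a) ∧ (a ≤ᵇ k)) _ X Y ⟩
    (if (b ≤ᵇ a) ∧ (a ≤ᵇ k) then X else 0ℚ) * (if (c ≤ᵇ d) ∧ (d ≤ᵇ k) then Y else 0ℚ)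
      ≡⟨ cong₂ _*_
           (trans (guard-cong refl λ t → let (b≤a , a≤k) = ≤ᵇ-chain b a k t in
                                         cong (q ^_) (odd-exponent k a b b≤a a≤k))
                  (guard-*ˡ ((b ≤ᵇ a) ∧ (a ≤ᵇ k)) q _))
           (cong (λ e → if (c ≤ᵇ d) ∧ (d ≤ᵇ k) then q ^ e else 0ℚ) (even-exponent k c d)) ⟩
    (q * triangleᵀ k a b) * triangle k c d ∎
    where
    open ≡-Reasoning
    X = q ^ (2 ℕ.* suc k ∸ 1 ∸ a ∸ b)
    Y = q ^ (2 ℕ.* suc k ∸ 2 ∸ c ∸ d)

module Evaluation (q : ℚ) (q≢1 : q ≢ 1ℚ) (q≢-1 : q ≢ - 1ℚ) (λ′ : ℕ → ℚ)
  (λ-odd : ∀ p → λ′ (2 ℕ.* p ℕ.+ 1) * ((1ℚ - q ^ 2) * (1ℚ - q))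
                 ≡ (1ℚ - q ^ (p ℕ.+ 2)) * (1ℚ - q ^ (p ℕ.+ 1)))
  (λ-even : ∀ p → λ′ (2 ℕ.* p ℕ.+ 2) ≡ q * λ′ (2 ℕ.* p ℕ.+ 1))
  (m : ℕ) where
  open Triangle q
  open Blocks q

  P : List (ℕ × ℕ)
  P = pairsUpTo m

  triangle-value : ∀ {k N₁ N₂} → k < N₁ → k < N₂ → sumTo² N₁ N₂ (triangle k) ≡ λ′ (suc (2 ℕ.* k))
  triangle-value {k} {N₁} {N₂} k<N₁ k<N₂ =
    trans (*-cancelʳ (denominator≢0 q q≢1 q≢-1) (trans (triangle-sum k N₁ N₂ k<N₁ k<N₂) (sym (λ-odd k))))
          (cong λ′ (ℕₚ.+-comm (2 ℕ.* k) 1))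

  triangleᵀ-value : ∀ {k N₁ N₂} → k < N₁ → k < N₂ →
                    sumTo² N₁ N₂ (triangleᵀ k) ≡ λ′ (suc (2 ℕ.* k))
  triangleᵀ-value {k} {N₁} {N₂} k<N₁ k<N₂ =
    trans (sumTo²-transpose N₁ N₂ (triangleᵀ k)) (triangle-value k<N₂ k<N₁)

  λ-even′ : ∀ {h k} → h ≡ 2 ℕ.* suc k → λ′ h ≡ q * λ′ (suc (2 ℕ.* k))
  λ-even′ {k = k} refl =
    trans (cong λ′ (trans (ℕₚ.*-suc 2 k) (ℕₚ.+-comm 2 (2 ℕ.* k))))
          (trans (λ-even k) (cong (λ i → q * λ′ i) (ℕₚ.+-comm (2 ℕ.* k) 1)))

  UD-value : ∀ {k} → k ≤ m → sumMap (uncurry (triangle k)) P ≡ λ′ (suc (2 ℕ.* k))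
  UD-value {k} k≤m =
    trans (sumMap-pairsUpTo (uncurry (triangle k)) m) (triangle-value (s≤s k≤m) (s≤s k≤m))

  UDᵀ-value : ∀ {k} → k ≤ m → sumMap (uncurry (triangleᵀ k)) P ≡ λ′ (suc (2 ℕ.* k))
  UDᵀ-value {k} k≤m =
    trans (sumMap-pairsUpTo (uncurry (triangleᵀ k)) m) (triangleᵀ-value (s≤s k≤m) (s≤s k≤m))

  -- the row a = 0 vanishes, the other rows are q·T-summands shifted by one
  DU-value : ∀ {k} → k < m → sumMap (weightDU (suc k)) P ≡ q * λ′ (suc (2 ℕ.* k))
  DU-value {k} k<m = begin
    sumMap (weightDU (suc k)) P
      ≡⟨ sumMap-pairsUpTo (weightDU (suc k)) m ⟩
    sumTo (suc m) (λ b → weightDU (suc k) (0 , b)) + sumTo² m (suc m) shifted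
      ≡⟨ cong (_+ sumTo² m (suc m) shifted) (sumTo-zero (suc m) (λ _ → refl)) ⟩
    0ℚ + sumTo² m (suc m) shifted
      ≡⟨ ℚₚ.+-identityˡ _ ⟩
    sumTo² m (suc m) shifted
      ≡⟨ sumTo-cong m (λ a → trans (sumTo-cong (suc m) (weightDU-shift k a))
                                   (sumTo-*ˡ (suc m) q (triangleᵀ k a))) ⟩
    sumTo m (λ a → q * sumTo (suc m) (triangleᵀ k a))
      ≡⟨ sumTo-*ˡ m q _ ⟩
    q * sumTo² m (suc m) (triangleᵀ k)
      ≡⟨ cong (q *_) (triangleᵀ-value k<m (ℕₚ.m≤n⇒m≤1+n k<m)) ⟩
    q * λ′ (suc (2 ℕ.* k)) ∎
    where
    open ≡-Reasoning
    shifted : ℕ → ℕ → ℚ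
    shifted a b = weightDU (suc k) (suc a , b)

  block-UD : ∀ {h k} s C → h ≡ 2 ℕ.* k → k ≤ m →
             historyTotal h (U ∷ D ∷ s) (extend P C) ≡ λ′ (suc h) * historyTotal h s C
  block-UD {h} {k} s C h≡2k k≤m = begin
    historyTotal h (U ∷ D ∷ s) (extend P C)
      ≡⟨ sumMap-extend-product _ (uncurry (triangle (h / 2))) (value ∘ dh q h s) (factor-UD h s) P C ⟩
    sumMap (uncurry (triangle (h / 2))) P * historyTotal h s C
      ≡⟨ cong (λ K → sumMap (uncurry (triangle K)) P * historyTotal h s C) (halve k h≡2k) ⟩
    sumMap (uncurry (triangle k)) P * historyTotal h s C
      ≡⟨ cong (_* historyTotal h s C) (trans (UD-value k≤m) (cong (λ′ ∘ suc) (sym h≡2k))) ⟩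
    λ′ (suc h) * historyTotal h s C ∎
    where open ≡-Reasoning

  block-DU : ∀ {h k} s C → h ≡ 2 ℕ.* suc k → k < m →
             historyTotal h (D ∷ U ∷ s) (extend P C) ≡ λ′ h * historyTotal h s C
  block-DU {h} {k} s C h≡2k+2 k<m = begin
    historyTotal h (D ∷ U ∷ s) (extend P C)
      ≡⟨ sumMap-extend-product _ (weightDU (h / 2)) (value ∘ dh q h s) (factor-DU h s) P C ⟩
    sumMap (weightDU (h / 2)) P * historyTotal h s C
      ≡⟨ cong (λ K → sumMap (weightDU K) P * historyTotal h s C) (halve (suc k) h≡2k+2) ⟩
    sumMap (weightDU (suc k)) P * historyTotal h s C
      ≡⟨ cong (_* historyTotal h s C) (trans (DU-value k<m) (sym (λ-even′ h≡2k+2))) ⟩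
    λ′ h * historyTotal h s C ∎
    where open ≡-Reasoning

  block-DD : ∀ {h k} s C → h ≡ 2 ℕ.* suc k → k ≤ m →
             historyTotal h (D ∷ D ∷ s) (extend P (extend P C))
             ≡ λ′ h * (λ′ (h ∸ 1) * historyTotal (h ∸ 2) s C)
  block-DD {h} {k} s C h≡2k+2 k≤m = begin
    historyTotal h (D ∷ D ∷ s) (extend P (extend P C))
      ≡⟨ sumMap-extend _ P (extend P C) ⟩
    sumMap (λ p₁ → sumMap (λ ξ → value (dh q h (D ∷ D ∷ s) (p₁ ∷ ξ))) (extend P C)) P
      ≡⟨ sumMap-cong inner P ⟩
    sumMap (λ p₁ → f p₁ * Σg * Σh) P
      ≡⟨ trans (sumMap-*ʳ Σh (λ p₁ → f p₁ * Σg) P) (cong (_* Σh) (sumMap-*ʳ Σg f P)) ⟩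
    sumMap f P * Σg * Σh
      ≡⟨ ℚₚ.*-assoc (sumMap f P) Σg Σh ⟩
    sumMap f P * (Σg * Σh)
      ≡⟨ cong₂ (λ u v → u * (v * Σh)) f-value g-value ⟩
    λ′ h * (λ′ (h ∸ 1) * Σh) ∎
    where
    open ≡-Reasoning
    f : ℕ × ℕ → ℚ
    f p = q * uncurry (triangleᵀ k) p
    g : ℕ × ℕ → ℚ
    g = uncurry (triangle k)
    Σg = sumMap g P
    Σh = historyTotal (h ∸ 2) s C
    factor : ∀ p₁ p₂ ξ →
             value (dh q h (D ∷ D ∷ s) (p₁ ∷ p₂ ∷ ξ)) ≡ (f p₁ * g p₂) * value (dh q (h ∸ 2) s ξ)
    factor p₁@(a , b) p₂@(c , d) ξ =
      trans (factor-DD h s p₁ p₂ ξ)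
            (cong (_* _) (trans (cong (λ K → weightDD K p₁ p₂) (halve (suc k) h≡2k+2))
                                (weightDD-split k a b c d)))
    inner : ∀ p₁ → sumMap (λ ξ → value (dh q h (D ∷ D ∷ s) (p₁ ∷ ξ))) (extend P C) ≡ f p₁ * Σg * Σh
    inner p₁ = trans (sumMap-extend-product _ (λ p₂ → f p₁ * g p₂) (value ∘ dh q (h ∸ 2) s) (factor p₁) P C)
                     (cong (_* Σh) (sumMap-*ˡ (f p₁) g P))
    f-value : sumMap f P ≡ λ′ h
    f-value = trans (sumMap-*ˡ q (uncurry (triangleᵀ k)) P)
                    (trans (cong (q *_) (UDᵀ-value k≤m)) (sym (λ-even′ h≡2k+2)))
    g-value : Σg ≡ λ′ (h ∸ 1)
    g-value = trans (UD-value k≤m) (cong (λ i → λ′ (i ∸ 1)) (trans (sym (two-suc k)) (sym h≡2k+2)))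

  half-height : ∀ {h} k s → h ≡ 2 ℕ.* k → dyckFrom h s ≡ true → downSteps s ≤ m → k ≤ m
  half-height {h} k s e d bound = half-bound k e (ℕₚ.≤-trans (descent h s d) bound)

  -- The clauses without a block lemma are excluded by the Dyck condition or by parity.
  history-sum : ∀ s h k → h ≡ 2 ℕ.* k → dyckFrom h s ≡ true → downSteps s ≤ m →
                historyTotal h s (xiCandidates (downSteps s) m) ≡ omegaFrom λ′ h s
  history-sum []          h             k       e  d  bound = refl
  history-sum (U ∷ [])    h             k       e  () bound
  history-sum (D ∷ [])    zero          k       e  () bound
  history-sum (D ∷ [])    (suc zero)    k       e  d  bound = ⊥-elim (odd≢even k e)
  history-sum (D ∷ [])    (suc (suc h)) k       e  () bound
  history-sum (U ∷ U ∷ s) h             k       e  d  bound =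
    history-sum s (suc (suc h)) (suc k) (trans (cong (suc ∘ suc) e) (sym (two-suc k))) d bound
  history-sum (U ∷ D ∷ s) h             k       e  d  bound =
    trans (block-UD s (xiCandidates (downSteps s) m) e (half-height k (U ∷ D ∷ s) e d bound))
          (cong (λ′ (suc h) *_) (history-sum s h k e d (ℕₚ.≤-trans (ℕₚ.n≤1+n _) bound)))
  history-sum (D ∷ U ∷ s) zero          k       e  () bound
  history-sum (D ∷ U ∷ s) (suc h)       zero    () d  bound
  history-sum (D ∷ U ∷ s) (suc h)       (suc k) e  d  bound =
    trans (block-DU s (xiCandidates (downSteps s) m) e (half-height (suc k) (D ∷ U ∷ s) e d bound))
          (cong (λ′ (suc h) *_) (history-sum s (suc h) (suc k) e d (ℕₚ.≤-trans (ℕₚ.n≤1+n _) bound)))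
  history-sum (D ∷ D ∷ s) zero          k       e  () bound
  history-sum (D ∷ D ∷ s) (suc zero)    k       e  () bound
  history-sum (D ∷ D ∷ s) (suc (suc h)) zero    () d  bound
  history-sum (D ∷ D ∷ s) (suc (suc h)) (suc k) e  d  bound =
    trans (block-DD s (xiCandidates (downSteps s) m) e (ℕₚ.<⇒≤ (half-height (suc k) (D ∷ D ∷ s) e d bound)))
          (cong (λ x → λ′ (suc (suc h)) * (λ′ (suc h) * x))
                (history-sum s h k e′ d (ℕₚ.≤-trans (ℕₚ.m≤n+m _ 2) bound)))
    where
    e′ : h ≡ 2 ℕ.* k
    e′ = ℕₚ.suc-injective (ℕₚ.suc-injective (trans e (two-suc k)))

proposition7 : (q : ℚ) → q ≢ 1ℚ → q ≢ - 1ℚ →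
    (λ′ : ℕ → ℚ) →
    (∀ p → λ′ (2 Data.Nat.* p Data.Nat.+ 1) * ((1ℚ - q ^ 2) * (1ℚ - q))
             ≡ (1ℚ - q ^ (p Data.Nat.+ 2)) * (1ℚ - q ^ (p Data.Nat.+ 1))) →
    (∀ p → λ′ (2 Data.Nat.* p Data.Nat.+ 2) ≡ q * λ′ (2 Data.Nat.* p Data.Nat.+ 1)) →
    (n : ℕ) → n ≥ 1 → (γ₀ : List Step) → IsDyck n γ₀ →
    dhSum q n γ₀ ≡ omega λ′ γ₀
proposition7 q q≢1 q≢-1 λ′ λ-odd λ-even n _ γ₀ (length≡2n , dyck) = begin
  dhSum q n γ₀
    ≡⟨ sumℚ-mapMaybe (dh q 0 γ₀) (xiCandidates n n) ⟩
  historyTotal 0 γ₀ (xiCandidates n n)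
    ≡⟨ cong (λ j → historyTotal 0 γ₀ (xiCandidates j n)) n≡downs ⟩
  historyTotal 0 γ₀ (xiCandidates (downSteps γ₀) n)
    ≡⟨ history-sum γ₀ 0 0 refl dyck (ℕₚ.≤-reflexive (sym n≡downs)) ⟩
  omega λ′ γ₀ ∎
  where
  open ≡-Reasoning
  open Blocks q using (historyTotal)
  open Evaluation q q≢1 q≢-1 λ′ λ-odd λ-even n using (history-sum)
  n≡downs : n ≡ downSteps γ₀
  n≡downs = ℕₚ.*-cancelˡ-≡ n (downSteps γ₀) 2 (trans (sym length≡2n) (length-downSteps 0 γ₀ dyck))
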